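{- Let $G$ be a minimal counterexample (as defined in the context). Let $u$ be a vertex of degree $7$ that is incident to six $2$-paths whose other endvertices have degree at most $5$. Then $u$ is not incident to a $3$-path, $u$ is not adjacent to a $(2,2,0)$-vertex, and $u$ is not incident to a further (seventh) $2$-path whose other endvertex has degree at most $6$.
   Context: A $2$-distance $k$-coloring of a graph assigns colors from $\{1,\dots,k\}$ so that distinct vertices at distance at most $2$ get different colors. A minimal counterexample is a finite simple graph $G$ with $\mathrm{mad}(G)\leq 18/7$ (equivalently $9|A|-7|E(G[A])|\geq 0$ for all $A\subseteq V(G)$), maximum degree $\Delta(G)=7$, that has no $2$-distance $8$-coloring, and such that every graph $H$ with $\mathrm{mad}(H)\leq 18/7$, maximum degree at most $7$ and $|V(H)|+|E(H)|<|V(G)|+|E(G)|$ has a $2$-distance $8$-coloring. A $k$-path is a path of length $k+1$ whose $k$ internal vertices have degree $2$ in $G$; a vertex is incident to a $k$-path if it is one of its endvertices. For a vertex $v$ of degree $d\geq 3$, each edge $vw$ starts a path incident to $v$: the maximal walk $v=x_0,x_1=w,\dots,x_{k+1}$ with $x_1,\dots,x_k$ of degree $2$ and $x_{k+1}$ not; it is a $k$-path. A $(2,2,0)$-vertex is a vertex of degree $3$ whose three incident paths are a $2$-path, a $2$-path and a $0$-path (an edge to a vertex of degree $\neq 2$). -}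

module Defs where

open import Data.Nat using (ℕ; zero; suc; _+_; _*_; _≤_; _<_)
open import Data.Nat.Base using (_<ᵇ_)
open import Data.Bool using (Bool; true; false; _∧_; if_then_else_)
open import Data.Fin using (Fin; zero; suc; toℕ; inject₁; fromℕ)
open import Data.Product using (Σ; ∃; _×_; _,_)
open import Data.Sum using (_⊎_)
open import Relation.Binary.PropositionalEquality using (_≡_; _≢_)
open import Relation.Nullary using (¬_)

record Graph : Set where
  field
    n      : ℕ
    adj    : Fin n → Fin n → Bool
    sym    : ∀ i j → adj i j ≡ adj j i
    irrefl : ∀ i → adj i i ≡ false

open Graph public

V : Graph → Set
V G = Fin (n G)

count : ∀ {m} → (Fin m → Bool) → ℕ
count {zero}  p = 0
count {suc m} p = (if p zero then 1 else 0) + count (λ i → p (suc i))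

sumF : ∀ {m} → (Fin m → ℕ) → ℕ
sumF {zero}  f = 0
sumF {suc m} f = f zero + sumF (λ i → f (suc i))

deg : (G : Graph) → V G → ℕ
deg G v = count (adj G v)

edgesIn : (G : Graph) → (V G → Bool) → ℕ
edgesIn G A = sumF (λ i → count (λ j →
  A i ∧ A j ∧ adj G i j ∧ (toℕ i <ᵇ toℕ j)))

numEdges : Graph → ℕ
numEdges G = edgesIn G (λ _ → true)

size : Graph → ℕ
size G = n G + numEdges G

-- mad(G) ≤ 18/7, i.e. 9|A| - 7|E(G[A])| ≥ 0 for all A ⊆ V(G)
MadBound : Graph → Set
MadBound G = ∀ (A : V G → Bool) → 7 * edgesIn G A ≤ 9 * count A

MaxDegAtMost : ℕ → Graph → Set
MaxDegAtMost d G = ∀ v → deg G v ≤ d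

Dist≤2 : (G : Graph) → V G → V G → Set
Dist≤2 G u v = adj G u v ≡ true ⊎ ∃ λ w → adj G u w ≡ true × adj G w v ≡ true

Is2DistColoring : (G : Graph) (k : ℕ) → (V G → Fin k) → Set
Is2DistColoring G k c = ∀ u v → u ≢ v → Dist≤2 G u v → c u ≢ c v

TwoDistColorable : Graph → ℕ → Set
TwoDistColorable G k = Σ (V G → Fin k) (Is2DistColoring G k)

MinimalCounterexample : Graph → Set
MinimalCounterexample G =
  MadBound G × MaxDegAtMost 7 G × (∃ λ v → deg G v ≡ 7) ×
  ¬ TwoDistColorable G 8 ×
  (∀ (H : Graph) → MadBound H → MaxDegAtMost 7 H → size H < size G →
     TwoDistColorable H 8)

-- A walk x₀,…,x_{k+1} (as a function on Fin (k+2)) that is the k-path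
-- starting at x₀ along the edge x₀x₁: consecutive vertices adjacent,
-- non-backtracking, x₁..x_k of degree 2 and x_{k+1} of degree ≠ 2.
IsKPath : (G : Graph) (k : ℕ) → (Fin (suc (suc k)) → V G) → Set
IsKPath G k x =
  (∀ (i : Fin (suc k)) → adj G (x (inject₁ i)) (x (suc i)) ≡ true) ×
  (∀ (j : Fin k) → x (inject₁ (inject₁ j)) ≢ x (suc (suc j))) ×
  (∀ (j : Fin k) → deg G (x (suc (inject₁ j))) ≡ 2) ×
  (deg G (x (fromℕ (suc k))) ≢ 2)

second : ∀ {G : Graph} {k} → (Fin (suc (suc k)) → V G) → V G
second x = x (suc zero)

endv : ∀ {G : Graph} {k} → (Fin (suc (suc k)) → V G) → V G
endv {k = k} x = x (fromℕ (suc k))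

KPathFrom : (G : Graph) (k : ℕ) → V G → (Fin (suc (suc k)) → V G) → Set
KPathFrom G k v x = IsKPath G k x × x zero ≡ v

Is220 : (G : Graph) → V G → Set
Is220 G v = deg G v ≡ 3 × Σ (Fin 4 → V G) λ p → Σ (Fin 4 → V G) λ q →
  Σ (Fin 2 → V G) λ r →
    KPathFrom G 2 v p × KPathFrom G 2 v q × KPathFrom G 0 v r ×
    second {G} p ≢ second {G} q × second {G} p ≢ second {G} r ×
    second {G} q ≢ second {G} r

-- Delete the edge from u to the first inner vertex of one of
-- its 2-paths and 2-distance 8-colour the smaller graph by minimality. Then recolour the inner
-- vertices of the 2-paths at u, u itself and, for a (2,2,0)-neighbour v, also v and the first
-- vertices of its 2-paths, in an order in which each vertex sees at most seven coloured vertices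
-- within distance 2, so a free colour always remains. With seven 2-paths at u, one of them ending
-- in x₃ of degree at most 6, u first takes the colour of x₃; then u and x₃ count as a single
-- colour for the two inner vertices of that path, which saves the colour they would lack.
-- A 3-path at u, or a seventh 2-path ending in a vertex of degree at most 6, yields seven such
-- 2-paths.

module Submission where

open import Defs
open import Data.Bool using (Bool; true; false; T; _∧_; _∨_; not)
open import Data.Bool.Properties using (∧-comm; ∨-comm; ∧-identityʳ; ∧-conicalˡ; T-≡)
open import Data.Empty using (⊥)
open import Data.Fin using (Fin; zero; suc; toℕ; #_)
import Data.Fin as Fin
open import Data.Fin.Properties using (_≟_; any?; all?; ¬∀⟶∃¬; injective⇒≤; toℕ-injective)
open import Data.List using (List; []; _∷_; length; map; lookup; _++_; allFin)
open import Data.List.Properties using (length-map)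
open import Data.List.Membership.Propositional using (_∈_; _∉_)
open import Data.List.Membership.Propositional.Properties using (∈-map⁺; ∈-++⁺ˡ; ∈-++⁺ʳ; ∈-allFin)
open import Data.List.Relation.Unary.Any using (here; there; index)
open import Data.List.Relation.Unary.Any.Properties using (lookup-index)
import Data.List.Membership.DecPropositional as DecMembership
open import Data.Nat using (ℕ; zero; suc; s≤s⁻¹; _≤?_; _+_; _≤_; _<_; z≤n; s≤s; _<ᵇ_)
open import Data.Nat.Properties
  using (≤-refl; ≤-trans; ≤-reflexive; m≤n⇒m≤1+n; m<n⇒m<1+n; 1+n≰n; +-mono-≤; +-mono-<-≤; +-mono-≤-<;
         +-monoʳ-<; *-monoʳ-≤; <-cmp; <⇒<ᵇ; <⇒≱)
open import Data.Product using (∃; _×_; _,_; proj₁; proj₂)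
open import Data.Sum using (_⊎_; inj₁; inj₂)
open import Data.Unit using (⊤; tt)
import Data.Vec.Functional as Vec
open import Data.Vec.Functional.Properties using (updateAt-updates; updateAt-minimal)
open import Function using (_∘_; const; id)
open import Function.Bundles using (Equivalence)
open import Function.Definitions using (Injective)
open import Relation.Binary.Definitions using (tri<; tri≈; tri>)
open import Relation.Binary.PropositionalEquality
  using (_≡_; _≢_; refl; trans; cong; subst)
import Relation.Binary.PropositionalEquality as ≡
open import Relation.Nullary using (¬_; Dec; yes; no; does; contradiction)
open import Relation.Nullary.Decidable using (dec-true; dec-false; True; toWitness; _⊎-dec_)

-- Counting over Fin

count-mono : ∀ {m} (p q : Fin m → Bool) → (∀ i → p i ≡ true → q i ≡ true) → count p ≤ count q
count-mono {zero}  p q p⇒q = z≤n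
count-mono {suc m} p q p⇒q with p zero in p₀ | q zero in q₀
... | true  | true  = s≤s (count-mono _ _ (p⇒q ∘ suc))
... | true  | false = contradiction (trans (≡.sym q₀) (p⇒q zero p₀)) λ ()
... | false | true  = m≤n⇒m≤1+n (count-mono _ _ (p⇒q ∘ suc))
... | false | false = count-mono _ _ (p⇒q ∘ suc)

count-mono-< : ∀ {m} (p q : Fin m → Bool) → (∀ i → p i ≡ true → q i ≡ true) →
               ∀ k → p k ≡ false → q k ≡ true → count p < count q
count-mono-< p q p⇒q zero pk qk rewrite pk | qk = s≤s (count-mono _ _ (p⇒q ∘ suc))
count-mono-< p q p⇒q (suc k) pk qk with p zero in p₀ | q zero in q₀
... | true  | true  = s≤s (count-mono-< _ _ (p⇒q ∘ suc) k pk qk)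
... | true  | false = contradiction (trans (≡.sym q₀) (p⇒q zero p₀)) λ ()
... | false | true  = m<n⇒m<1+n (count-mono-< _ _ (p⇒q ∘ suc) k pk qk)
... | false | false = count-mono-< _ _ (p⇒q ∘ suc) k pk qk

count-cong : ∀ {m} (p q : Fin m → Bool) → (∀ i → p i ≡ q i) → count p ≡ count q
count-cong {zero}  p q p≗q = refl
count-cong {suc m} p q p≗q rewrite p≗q zero = cong (_+_ _) (count-cong _ _ (p≗q ∘ suc))

sumF-mono : ∀ {m} (f g : Fin m → ℕ) → (∀ i → f i ≤ g i) → sumF f ≤ sumF g
sumF-mono {zero}  f g f≤g = z≤n
sumF-mono {suc m} f g f≤g = +-mono-≤ (f≤g zero) (sumF-mono _ _ (f≤g ∘ suc))

sumF-mono-< : ∀ {m} (f g : Fin m → ℕ) → (∀ i → f i ≤ g i) → ∀ k → f k < g k → sumF f < sumF g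
sumF-mono-< f g f≤g zero    fk<gk = +-mono-<-≤ fk<gk (sumF-mono _ _ (f≤g ∘ suc))
sumF-mono-< f g f≤g (suc k) fk<gk = +-mono-≤-< (f≤g zero) (sumF-mono-< _ _ (f≤g ∘ suc) k fk<gk)

satisfying : ∀ {m} → (Fin m → Bool) → List (Fin m)
satisfying {zero}  p = []
satisfying {suc m} p with p zero
... | true  = zero ∷ map suc (satisfying (p ∘ suc))
... | false = map suc (satisfying (p ∘ suc))

length-satisfying : ∀ {m} (p : Fin m → Bool) → length (satisfying p) ≡ count p
length-satisfying {zero}  p = refl
length-satisfying {suc m} p with p zero
... | true  = cong suc (trans (length-map Fin.suc (satisfying (p ∘ suc))) (length-satisfying (p ∘ suc)))
... | false = trans (length-map Fin.suc (satisfying (p ∘ suc))) (length-satisfying (p ∘ suc))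

∈-satisfying : ∀ {m} (p : Fin m → Bool) {i} → p i ≡ true → i ∈ satisfying p
∈-satisfying {suc m} p {zero} pi with p zero
... | true = here refl
∈-satisfying {suc m} p {zero} () | false
∈-satisfying {suc m} p {suc i} pi with p zero
... | true  = there (∈-map⁺ suc (∈-satisfying (p ∘ suc) pi))
... | false = ∈-map⁺ suc (∈-satisfying (p ∘ suc) pi)

count-except : ∀ {m} (p : Fin m → Bool) {z} → p z ≡ true →
               suc (count (λ y → p y ∧ not (does (y ≟ z)))) ≡ count p
count-except {suc m} p {zero} pz rewrite pz = cong suc (count-cong _ _ (∧-identityʳ ∘ p ∘ suc))
count-except {suc m} p {suc z} pz with p zero
... | true  = cong suc (count-except (p ∘ suc) pz)
... | false = count-except (p ∘ suc) pz

injective⇒≤length : ∀ {a} {A : Set a} {m} (xs : List A) (g : Fin m → A) →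
                    Injective _≡_ _≡_ g → (∀ i → g i ∈ xs) → m ≤ length xs
injective⇒≤length xs g g-inj g∈xs = injective⇒≤ λ {i} {j} same-index → g-inj (begin
  g i                                  ≡⟨ lookup-index (g∈xs i) ⟩
  lookup xs (index (g∈xs i)) ≡⟨ cong (lookup xs) same-index ⟩
  lookup xs (index (g∈xs j)) ≡⟨ lookup-index (g∈xs j) ⟨
  g j                                  ∎)
  where open ≡.≡-Reasoning

module _ where
  open DecMembership (_≟_ {8}) using (_∈?_)

  freshColour : (cs : List (Fin 8)) → length cs ≤ 7 → ∃ λ c → c ∉ cs
  freshColour cs few with all? (_∈? cs)
  ... | yes every = contradiction (≤-trans (injective⇒≤length cs id id every) few) 1+n≰n
  ... | no  some  = ¬∀⟶∃¬ 8 _ (_∈? cs) some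

-- Neighbourhoods and 2-paths

injective-from-tail : ∀ {a} {A : Set a} {k} {f : Fin (suc k) → A} →
                      (∀ i → f zero ≢ f (suc i)) → Injective _≡_ _≡_ (f ∘ suc) → Injective _≡_ _≡_ f
injective-from-tail head-new tail-inj {zero}  {zero}  _ = refl
injective-from-tail head-new tail-inj {zero}  {suc j} e = contradiction e (head-new j)
injective-from-tail head-new tail-inj {suc i} {zero}  e = contradiction (≡.sym e) (head-new i)
injective-from-tail head-new tail-inj {suc i} {suc j} e = cong suc (tail-inj e)

module _ (G : Graph) where

  adj-sym : ∀ {x y} → adj G x y ≡ true → adj G y x ≡ true
  adj-sym {x} {y} = trans (sym G y x)

  adj⇒≢ : ∀ {x y} → adj G x y ≡ true → x ≢ y
  adj⇒≢ {x} x~x refl = contradiction (trans (≡.sym (irrefl G x)) x~x) λ ()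

  deg⇒≢ : ∀ {x y m n} → deg G x ≡ m → deg G y ≡ n → m ≢ n → x ≢ y
  deg⇒≢ dx dy m≢n refl = m≢n (trans (≡.sym dx) dy)

  deg-≢⇒≢ : ∀ {x y n} → deg G x ≢ n → deg G y ≡ n → x ≢ y
  deg-≢⇒≢ dx≢n dy refl = dx≢n dy

  deg-≤⇒≢ : ∀ {x y m} → deg G x ≤ m → m < deg G y → x ≢ y
  deg-≤⇒≢ dx≤m m<dy refl = <⇒≱ m<dy dx≤m

  Dist≤2-sym : ∀ {x y} → Dist≤2 G x y → Dist≤2 G y x
  Dist≤2-sym (inj₁ x~y)             = inj₁ (adj-sym x~y)
  Dist≤2-sym (inj₂ (m , x~m , m~y)) = inj₂ (m , adj-sym m~y , adj-sym x~m)

  neighbours-listed : ∀ {k x} → deg G x ≡ k → (g : Fin k → V G) → Injective _≡_ _≡_ g →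
                      (∀ i → adj G x (g i) ≡ true) → ∀ {y} → adj G x y ≡ true → ∃ λ i → y ≡ g i
  neighbours-listed {k} {x} dx g g-inj x~g {y} x~y with any? (λ i → y ≟ g i)
  ... | yes listed  = listed
  ... | no  missing = contradiction (≤-trans too-many bound) 1+n≰n
    where
      all-adjacent : ∀ i → (y Vec.∷ g) i ∈ satisfying (adj G x)
      all-adjacent zero    = ∈-satisfying _ x~y
      all-adjacent (suc i) = ∈-satisfying _ (x~g i)
      too-many : suc k ≤ length (satisfying (adj G x))
      too-many = injective⇒≤length _ (y Vec.∷ g) (injective-from-tail (λ i e → missing (i , e)) g-inj) all-adjacent
      bound : length (satisfying (adj G x)) ≤ k
      bound = ≤-reflexive (trans (length-satisfying (adj G x)) dx)

  neighbours-of-degree-2 : ∀ {x p q} → deg G x ≡ 2 → adj G x p ≡ true → adj G x q ≡ true → p ≢ q →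
                           ∀ {y} → adj G x y ≡ true → y ≡ p ⊎ y ≡ q
  neighbours-of-degree-2 {p = p} {q} dx x~p x~q p≢q x~y
    with neighbours-listed dx (p Vec.∷ q Vec.∷ Vec.[])
           (injective-from-tail (λ { zero → p≢q ; (suc ()) }) (injective-from-tail (λ ()) λ { {()} }))
           (λ { zero → x~p ; (suc zero) → x~q ; (suc (suc ())) }) x~y
  ... | zero     , y≡p = inj₁ y≡p
  ... | suc zero , y≡q = inj₂ y≡q

  neighbours-of-degree-3 : ∀ {x p q r} → deg G x ≡ 3 →
                           adj G x p ≡ true → adj G x q ≡ true → adj G x r ≡ true →
                           p ≢ q → p ≢ r → q ≢ r →
                           ∀ {y} → adj G x y ≡ true → y ≡ p ⊎ y ≡ q ⊎ y ≡ r
  neighbours-of-degree-3 {p = p} {q} {r} dx x~p x~q x~r p≢q p≢r q≢r x~y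
    with neighbours-listed dx (p Vec.∷ q Vec.∷ r Vec.∷ Vec.[])
           (injective-from-tail (λ { zero → p≢q ; (suc zero) → p≢r ; (suc (suc ())) })
             (injective-from-tail (λ { zero → q≢r ; (suc ()) }) (injective-from-tail (λ ()) λ { {()} })))
           (λ { zero → x~p ; (suc zero) → x~q ; (suc (suc zero)) → x~r ; (suc (suc (suc ()))) }) x~y
  ... | zero           , y≡p = inj₁ y≡p
  ... | suc zero       , y≡q = inj₂ (inj₁ y≡q)
  ... | suc (suc zero) , y≡r = inj₂ (inj₂ y≡r)

  otherNeighbours : V G → V G → List (V G)
  otherNeighbours x z = satisfying (λ y → adj G x y ∧ not (does (y ≟ z)))

  ∈-otherNeighbours : ∀ {x y z} → adj G x y ≡ true → y ≢ z → y ∈ otherNeighbours x z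
  ∈-otherNeighbours {y = y} {z} x~y y≢z = ∈-satisfying _ (≡.cong₂ _∧_ x~y (cong not (dec-false (y ≟ z) y≢z)))

  length-otherNeighbours : ∀ {x z d} → adj G x z ≡ true → deg G x ≤ suc d → length (otherNeighbours x z) ≤ d
  length-otherNeighbours {x} {z} x~z bound =
    s≤s⁻¹ (≤-trans (≤-reflexive (trans (cong suc length≡count) (count-except (adj G x) x~z))) bound)
    where
      length≡count : length (otherNeighbours x z) ≡ count (λ y → adj G x y ∧ not (does (y ≟ z)))
      length≡count = length-satisfying (λ y → adj G x y ∧ not (does (y ≟ z)))

  -- Unlike a 2-path, x₃ may have degree 2, so the first three edges of a 3-path also form a Path2.
  record Path2 (s : V G) : Set where
    field
      x₁ x₂ x₃ : V G
      s~x₁     : adj G s x₁ ≡ true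
      x₁~x₂    : adj G x₁ x₂ ≡ true
      x₂~x₃    : adj G x₂ x₃ ≡ true
      deg-x₁   : deg G x₁ ≡ 2
      deg-x₂   : deg G x₂ ≡ 2
      s≢x₂     : s ≢ x₂
      x₁≢x₃    : x₁ ≢ x₃

    neighbours-x₁ : ∀ {y} → adj G x₁ y ≡ true → y ≡ s ⊎ y ≡ x₂
    neighbours-x₁ = neighbours-of-degree-2 deg-x₁ (adj-sym s~x₁) x₁~x₂ s≢x₂

    neighbours-x₂ : ∀ {y} → adj G x₂ y ≡ true → y ≡ x₁ ⊎ y ≡ x₃
    neighbours-x₂ = neighbours-of-degree-2 deg-x₂ (adj-sym x₁~x₂) x₂~x₃ x₁≢x₃

    ball-x₁ : ∀ {y} → Dist≤2 G x₁ y → y ≢ x₁ → y ≡ s ⊎ y ≡ x₂ ⊎ y ≡ x₃ ⊎ adj G s y ≡ true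
    ball-x₁ (inj₁ x₁~y) _ with neighbours-x₁ x₁~y
    ... | inj₁ y≡s  = inj₁ y≡s
    ... | inj₂ y≡x₂ = inj₂ (inj₁ y≡x₂)
    ball-x₁ (inj₂ (m , x₁~m , m~y)) y≢x₁ with neighbours-x₁ x₁~m
    ... | inj₁ refl = inj₂ (inj₂ (inj₂ m~y))
    ... | inj₂ refl with neighbours-x₂ m~y
    ...   | inj₁ y≡x₁ = contradiction y≡x₁ y≢x₁
    ...   | inj₂ y≡x₃ = inj₂ (inj₂ (inj₁ y≡x₃))

    ball-x₂ : ∀ {y} → Dist≤2 G x₂ y → y ≢ x₂ → y ≡ x₁ ⊎ y ≡ x₃ ⊎ y ≡ s ⊎ adj G x₃ y ≡ true
    ball-x₂ (inj₁ x₂~y) _ with neighbours-x₂ x₂~y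
    ... | inj₁ y≡x₁ = inj₁ y≡x₁
    ... | inj₂ y≡x₃ = inj₂ (inj₁ y≡x₃)
    ball-x₂ (inj₂ (m , x₂~m , m~y)) y≢x₂ with neighbours-x₂ x₂~m
    ... | inj₂ refl = inj₂ (inj₂ (inj₂ m~y))
    ... | inj₁ refl with neighbours-x₁ m~y
    ...   | inj₁ y≡s  = inj₂ (inj₂ (inj₁ y≡s))
    ...   | inj₂ y≡x₂ = contradiction y≡x₂ y≢x₂

    walk-from-x₁ : ∀ {z₂ z₃} → adj G x₁ z₂ ≡ true → adj G z₂ z₃ ≡ true → x₁ ≢ z₃ → z₂ ≢ s → z₃ ≡ x₃
    walk-from-x₁ x₁~z₂ z₂~z₃ x₁≢z₃ z₂≢s with neighbours-x₁ x₁~z₂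
    ... | inj₁ z₂≡s = contradiction z₂≡s z₂≢s
    ... | inj₂ refl with neighbours-x₂ z₂~z₃
    ...   | inj₁ z₃≡x₁ = contradiction (≡.sym z₃≡x₁) x₁≢z₃
    ...   | inj₂ z₃≡x₃ = z₃≡x₃

    walk-from-x₂ : ∀ {z₂ z₃} → adj G x₂ z₂ ≡ true → adj G z₂ z₃ ≡ true → x₂ ≢ z₃ → z₂ ≡ x₃ ⊎ z₃ ≡ s
    walk-from-x₂ x₂~z₂ z₂~z₃ x₂≢z₃ with neighbours-x₂ x₂~z₂
    ... | inj₂ z₂≡x₃ = inj₁ z₂≡x₃
    ... | inj₁ refl with neighbours-x₁ z₂~z₃
    ...   | inj₁ z₃≡s  = inj₂ z₃≡s
    ...   | inj₂ z₃≡x₂ = contradiction (≡.sym z₃≡x₂) x₂≢z₃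

  path⇒Path2 : ∀ {s k} x → KPathFrom G (suc (suc k)) s x → Path2 s
  path⇒Path2 x ((edge , no-backtrack , inner-deg , _) , x₀≡s) = record
    { x₁ = x (# 1) ; x₂ = x (# 2) ; x₃ = x (# 3)
    ; s~x₁ = subst (λ z → adj G z (x (# 1)) ≡ true) x₀≡s (edge (# 0))
    ; x₁~x₂ = edge (# 1) ; x₂~x₃ = edge (# 2)
    ; deg-x₁ = inner-deg (# 0) ; deg-x₂ = inner-deg (# 1)
    ; s≢x₂ = λ s≡x₂ → no-backtrack (# 0) (trans x₀≡s s≡x₂) ; x₁≢x₃ = no-backtrack (# 1) }

  deg-end-2-path : ∀ {s} x (P : KPathFrom G 2 s x) → deg G (Path2.x₃ (path⇒Path2 x P)) ≢ 2
  deg-end-2-path x ((_ , _ , _ , deg-end) , _) = deg-end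

  deg-x₃-3-path : ∀ {s} x (P : KPathFrom G 3 s x) → deg G (Path2.x₃ (path⇒Path2 x P)) ≡ 2
  deg-x₃-3-path x ((_ , _ , inner-deg , _) , _) = inner-deg (# 2)

-- Deleting an edge

∧-true-monoˡ : ∀ {a b} c → (a ≡ true → b ≡ true) → a ∧ c ≡ true → b ∧ c ≡ true
∧-true-monoˡ {true} c a⇒b e rewrite a⇒b refl = e

∧-true-monoʳ : ∀ a {b c} → (b ≡ true → c ≡ true) → a ∧ b ≡ true → a ∧ c ≡ true
∧-true-monoʳ true  b⇒c = b⇒c
∧-true-monoʳ false b⇒c = id

isPair : ∀ {m} → Fin m → Fin m → Fin m → Fin m → Bool
isPair x y i j = (does (i ≟ x) ∧ does (j ≟ y)) ∨ (does (i ≟ y) ∧ does (j ≟ x))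

isPair-sym : ∀ {m} (x y i j : Fin m) → isPair x y i j ≡ isPair x y j i
isPair-sym x y i j rewrite ∧-comm (does (i ≟ x)) (does (j ≟ y)) | ∧-comm (does (i ≟ y)) (does (j ≟ x)) =
  ∨-comm (does (j ≟ y) ∧ does (i ≟ x)) (does (j ≟ x) ∧ does (i ≟ y))

isPair-refl : ∀ {m} (x y : Fin m) → isPair x y x y ≡ true
isPair-refl x y rewrite dec-true (x ≟ x) refl | dec-true (y ≟ y) refl = refl

deleteEdge : (G : Graph) → V G → V G → Graph
deleteEdge G x y = record
  { n      = n G
  ; adj    = λ i j → adj G i j ∧ not (isPair x y i j)
  ; sym    = λ i j → ≡.cong₂ (λ a b → a ∧ not b) (sym G i j) (isPair-sym x y i j)
  ; irrefl = λ i → cong (_∧ _) (irrefl G i)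
  }

module _ (G : Graph) {x y : V G} where

  private
    H : Graph
    H = deleteEdge G x y

  adj-deleteEdge⇒adj : ∀ {i j} → adj H i j ≡ true → adj G i j ≡ true
  adj-deleteEdge⇒adj = ∧-conicalˡ _ _

  adj⇒adj-deleteEdge : ∀ {i j} → i ≢ x → i ≢ y → adj G i j ≡ true → adj H i j ≡ true
  adj⇒adj-deleteEdge {i} i≢x i≢y i~j rewrite dec-false (i ≟ x) i≢x | dec-false (i ≟ y) i≢y | i~j = refl

  Dist≤2-deleteEdge : ∀ {i j} → i ≢ x → i ≢ y → j ≢ x → j ≢ y → Dist≤2 G i j → Dist≤2 H i j
  Dist≤2-deleteEdge i≢x i≢y j≢x j≢y (inj₁ i~j) = inj₁ (adj⇒adj-deleteEdge i≢x i≢y i~j)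
  Dist≤2-deleteEdge i≢x i≢y j≢x j≢y (inj₂ (m , i~m , m~j)) =
    inj₂ (m , adj⇒adj-deleteEdge i≢x i≢y i~m , adj-sym H (adj⇒adj-deleteEdge j≢x j≢y (adj-sym G m~j)))

  deg-deleteEdge-≤ : ∀ v → deg H v ≤ deg G v
  deg-deleteEdge-≤ v = count-mono (adj H v) (adj G v) λ _ → adj-deleteEdge⇒adj

  madBound-deleteEdge : MadBound G → MadBound H
  madBound-deleteEdge mad A = ≤-trans (*-monoʳ-≤ 7 fewer-edges) (mad A)
    where
      fewer-edges : edgesIn H A ≤ edgesIn G A
      fewer-edges = sumF-mono _ _ λ i → count-mono _ _ λ j →
        ∧-true-monoʳ (A i) (∧-true-monoʳ (A j) (∧-true-monoˡ _ adj-deleteEdge⇒adj))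

  numEdges-deleteEdge-< : ∀ {i j} → adj G i j ≡ true → isPair x y i j ≡ true → T (toℕ i <ᵇ toℕ j) →
                          numEdges H < numEdges G
  numEdges-deleteEdge-< {i} {j} i~j ij-deleted i<j =
    sumF-mono-< (count ∘ below H) (count ∘ below G) (λ k → count-mono _ _ (fewer k)) i
      (count-mono-< (below H i) (below G i) (fewer i) j absent present)
    where
      below : (K : Graph) → V K → V K → Bool
      below K k l = adj K k l ∧ (toℕ k <ᵇ toℕ l)
      fewer : ∀ k l → below H k l ≡ true → below G k l ≡ true
      fewer k l = ∧-true-monoˡ _ adj-deleteEdge⇒adj
      absent : adj H i j ∧ (toℕ i <ᵇ toℕ j) ≡ false
      absent rewrite i~j | ij-deleted = refl
      present : adj G i j ∧ (toℕ i <ᵇ toℕ j) ≡ true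
      present rewrite i~j = Equivalence.to T-≡ i<j

  size-deleteEdge-< : adj G x y ≡ true → size H < size G
  size-deleteEdge-< x~y = +-monoʳ-< (n G) fewer
    where
      fewer : numEdges H < numEdges G
      fewer with <-cmp (toℕ x) (toℕ y)
      ... | tri< x<y _ _ = numEdges-deleteEdge-< x~y (isPair-refl x y) (<⇒<ᵇ x<y)
      ... | tri≈ _ x≡y _ = contradiction (toℕ-injective x≡y) (adj⇒≢ G x~y)
      ... | tri> _ _ y<x = numEdges-deleteEdge-< (adj-sym G x~y)
                             (trans (≡.sym (isPair-sym x y x y)) (isPair-refl x y)) (<⇒<ᵇ y<x)

-- Recolouring

module Recolouring (G : Graph) where

  Colouring : Set
  Colouring = V G → Fin 8

  recolour : Colouring → V G → Fin 8 → Colouring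
  recolour f r c = Vec.updateAt f r (const c)

  Step : Set
  Step = V G × (Colouring → Fin 8)

  run : Colouring → List Step → Colouring
  run f []                     = f
  run f ((r , choose) ∷ steps) = run (recolour f r (choose f)) steps

  recoloured : List Step → List (V G)
  recoloured = map proj₁

  ProperAwayFrom : Colouring → List (V G) → Set
  ProperAwayFrom f pending =
    ∀ x y → x ≢ y → Dist≤2 G x y → x ∉ pending → y ∉ pending → f x ≢ f y

  SafeChoice : Colouring → V G → Fin 8 → List (V G) → Set
  SafeChoice f r c pending = ∀ y → Dist≤2 G r y → y ≢ r → y ∈ pending ⊎ c ≢ f y

  recolour-proper : ∀ {f r c pending} → ProperAwayFrom f (r ∷ pending) → SafeChoice f r c pending →
                    ProperAwayFrom (recolour f r c) pending
  recolour-proper {f} {r} {c} proper safe x y x≢y near x∉ y∉ with x ≟ r | y ≟ r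
  ... | yes refl | yes refl = contradiction refl x≢y
  ... | yes refl | no y≢r
    rewrite updateAt-updates r {const c} f | updateAt-minimal y r {const c} f y≢r
    with safe y near y≢r
  ...   | inj₁ y∈ = contradiction y∈ y∉
  ...   | inj₂ c≢ = c≢
  recolour-proper {f} {r} {c} proper safe x y x≢y near x∉ y∉ | no x≢r | yes refl
    rewrite updateAt-updates r {const c} f | updateAt-minimal x r {const c} f x≢r
    with safe x (Dist≤2-sym G near) x≢r
  ...   | inj₁ x∈ = contradiction x∈ x∉
  ...   | inj₂ c≢ = c≢ ∘ ≡.sym
  recolour-proper {f} {r} {c} proper safe x y x≢y near x∉ y∉ | no x≢r | no y≢r
    rewrite updateAt-minimal x r {const c} f x≢r | updateAt-minimal y r {const c} f y≢r =
    proper x y x≢y near (λ { (here x≡r) → x≢r x≡r ; (there x∈) → x∉ x∈ })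
                        (λ { (here y≡r) → y≢r y≡r ; (there y∈) → y∉ y∈ })

  -- Opaque because unfolding Safe along a concrete list of steps makes type checking explode.
  opaque
    Safe : Colouring → List Step → Set
    Safe f []                     = ⊤
    Safe f ((r , choose) ∷ steps) =
      SafeChoice f r (choose f) (recoloured steps) × Safe (recolour f r (choose f)) steps

    run-proper : ∀ f steps → ProperAwayFrom f (recoloured steps) → Safe f steps → Is2DistColoring G 8 (run f steps)
    run-proper f []                     proper _             x y x≢y near = proper x y x≢y near (λ ()) (λ ())
    run-proper f ((r , choose) ∷ steps) proper (safe , rest) =
      run-proper _ steps (recolour-proper proper safe) rest

  record GreedyStep : Set where
    constructor greedy
    field
      vertex : V G
      avoid  : List (V G)
      few    : length avoid ≤ 7

  open GreedyStep public

  freshFor : ∀ f g → ∃ λ c → c ∉ map f (avoid g)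
  freshFor f g = freshColour (map f (avoid g)) (≤-trans (≤-reflexive (length-map f (avoid g))) (few g))

  greedyColour : Colouring → GreedyStep → Fin 8
  greedyColour f g = proj₁ (freshFor f g)

  greedyColour-avoids : ∀ f g {y} → y ∈ avoid g → greedyColour f g ≢ f y
  greedyColour-avoids f g y∈ c≡fy = proj₂ (freshFor f g) (subst (_∈ map f (avoid g)) (≡.sym c≡fy) (∈-map⁺ f y∈))

  toStep : GreedyStep → Step
  toStep g = vertex g , λ f → greedyColour f g

  -- The greedy steps may treat t as a copy of s: while f s ≡ f t, avoiding s also avoids t.
  -- With s ≡ t this is no constraint at all.
  module WithCopy (s t : V G) where

    Avoided : List (V G) → V G → Set
    Avoided F y = y ∈ F ⊎ (y ≡ t × s ∈ F)

    Covered : GreedyStep → List (V G) → Set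
    Covered g pending =
      (∀ y → Dist≤2 G (vertex g) y → y ≢ vertex g → y ∈ pending ⊎ Avoided (avoid g) y) ×
      ((vertex g ≢ s × vertex g ≢ t) ⊎ s ≡ t)

    AllCovered : List GreedyStep → Set
    AllCovered []       = ⊤
    AllCovered (g ∷ gs) = Covered g (recoloured (map toStep gs)) × AllCovered gs

    allCovered-map : ∀ {a} {A : Set a} (h : A → GreedyStep) → (∀ k pending → Covered (h k) pending) →
                     ∀ ks → AllCovered (map h ks)
    allCovered-map h covered []       = tt
    allCovered-map h covered (k ∷ ks) = covered k _ , allCovered-map h covered ks

    recolour-keeps-copy : ∀ {f r c} → f s ≡ f t → (r ≢ s × r ≢ t) ⊎ s ≡ t →
                          recolour f r c s ≡ recolour f r c t
    recolour-keeps-copy {f} {r} {c} fs≡ft (inj₁ (r≢s , r≢t)) = begin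
      recolour f r c s ≡⟨ updateAt-minimal s r f (r≢s ∘ ≡.sym) ⟩
      f s              ≡⟨ fs≡ft ⟩
      f t              ≡⟨ updateAt-minimal t r f (r≢t ∘ ≡.sym) ⟨
      recolour f r c t ∎
      where open ≡.≡-Reasoning
    recolour-keeps-copy fs≡ft (inj₂ refl) = refl

    opaque
      unfolding Safe

      greedy-safe : ∀ f → f s ≡ f t → ∀ gs → AllCovered gs → Safe f (map toStep gs)
      greedy-safe f fs≡ft []       _                                 = tt
      greedy-safe f fs≡ft (g ∷ gs) ((near , untouched) , covered) = safe , greedy-safe _ (recolour-keeps-copy fs≡ft untouched) gs covered
        where
          safe : SafeChoice f (vertex g) (greedyColour f g) (recoloured (map toStep gs))
          safe y d y≢ with near y d y≢
          ... | inj₁ y∈                = inj₁ y∈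
          ... | inj₂ (inj₁ y∈)         = inj₂ (greedyColour-avoids f g y∈)
          ... | inj₂ (inj₂ (refl , s∈)) = inj₂ (greedyColour-avoids f g s∈ ∘ λ c≡ → trans c≡ (≡.sym fs≡ft))

      copy-then-greedy-safe : ∀ f gs → t ≢ s → SafeChoice f s (f t) (recoloured (map toStep gs)) →
                              AllCovered gs → Safe f ((s , λ f → f t) ∷ map toStep gs)
      copy-then-greedy-safe f gs t≢s copy-safe covered =
        copy-safe , greedy-safe _ (trans (updateAt-updates s f) (≡.sym (updateAt-minimal t s f t≢s))) gs covered

no-safe-recolouring : ∀ {G x y} → MinimalCounterexample G → adj G x y ≡ true →
                      let open Recolouring G in
                      (steps : List Step) → x ∈ recoloured steps → y ∈ recoloured steps →
                      (∀ f → Safe f steps) → ⊥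
no-safe-recolouring {G} {x} {y} (mad , Δ≤7 , _ , uncolourable , minimal) x~y steps x∈ y∈ safe =
  uncolourable (run c steps , run-proper c steps proper-elsewhere (safe c))
  where
    open Recolouring G
    H : Graph
    H = deleteEdge G x y
    colouringH : TwoDistColorable H 8
    colouringH = minimal H (madBound-deleteEdge G mad) (λ v → ≤-trans (deg-deleteEdge-≤ G v) (Δ≤7 v))
                   (size-deleteEdge-< G x~y)
    c : Colouring
    c = proj₁ colouringH
    ∉⇒≢ : ∀ {v w} → v ∉ recoloured steps → w ∈ recoloured steps → v ≢ w
    ∉⇒≢ v∉ w∈ refl = v∉ w∈
    proper-elsewhere : ProperAwayFrom c (recoloured steps)
    proper-elsewhere v w v≢w near v∉ w∉ = proj₂ colouringH v w v≢w
      (Dist≤2-deleteEdge G (∉⇒≢ v∉ x∈) (∉⇒≢ v∉ y∈) (∉⇒≢ w∉ x∈) (∉⇒≢ w∉ y∈) near)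

-- The reducible configurations

Partition : ∀ {m} → Fin m → List (Fin m) → List (Fin m) → Set
Partition k before after = ∀ j → j ≡ k ⊎ j ∈ before ⊎ j ∈ after

partition? : ∀ {m} (k : Fin m) before after → Dec (Partition k before after)
partition? k before after = all? λ j → (j ≟ k) ⊎-dec ((j ∈? before) ⊎-dec (j ∈? after))
  where open DecMembership _≟_ using (_∈?_)

module SevenTwoPaths {G : Graph} (mc : MinimalCounterexample G) {u : V G} (deg-u : deg G u ≡ 7)
    (P : Fin 7 → Path2 G u) (x₁-injective : Injective _≡_ _≡_ (Path2.x₁ ∘ P))
    (deg-x₃ : ∀ i → deg G (Path2.x₃ (P (suc i))) ≤ 5)
    (deg-x₃₀ : deg G (Path2.x₃ (P zero)) ≤ 6)
    (x₃₀≢u : Path2.x₃ (P zero) ≢ u)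
    (x₃₀≢x₁ : ∀ j → Path2.x₃ (P zero) ≢ Path2.x₁ (P j))
    (x₃₀≢x₂ : ∀ j → Path2.x₃ (P zero) ≢ Path2.x₂ (P j)) where

  a b w : Fin 7 → V G
  a = Path2.x₁ ∘ P
  b = Path2.x₂ ∘ P
  w = Path2.x₃ ∘ P

  open Recolouring G
  open WithCopy u (w zero)

  neighbours-u : ∀ {y} → adj G u y ≡ true → ∃ λ j → y ≡ a j
  neighbours-u = neighbours-listed G deg-u a x₁-injective (Path2.s~x₁ ∘ P)

  a-covered : ∀ k {F pending} → u ∈ F → b k ∈ pending → Avoided F (w k) →
              (∀ j → j ≢ k → a j ∈ F ⊎ a j ∈ pending) →
              ∀ y → Dist≤2 G (a k) y → y ≢ a k → y ∈ pending ⊎ Avoided F y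
  a-covered k u∈ bk∈ wk-avoided others y near y≢ak with Path2.ball-x₁ (P k) near y≢ak
  ... | inj₁ refl                     = inj₂ (inj₁ u∈)
  ... | inj₂ (inj₁ refl)              = inj₁ bk∈
  ... | inj₂ (inj₂ (inj₁ refl))       = inj₂ wk-avoided
  ... | inj₂ (inj₂ (inj₂ u~y)) with neighbours-u u~y
  ...   | j , refl with others j (λ { refl → y≢ak refl })
  ...     | inj₁ aj∈ = inj₂ (inj₁ aj∈)
  ...     | inj₂ aj∈ = inj₁ aj∈

  b-covered : ∀ k {F pending} → a k ∈ F → u ∈ F → Avoided F (w k) →
              (∀ {y} → adj G (w k) y ≡ true → y ≢ b k → y ∈ F) →
              ∀ y → Dist≤2 G (b k) y → y ≢ b k → y ∈ pending ⊎ Avoided F y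
  b-covered k ak∈ u∈ wk-avoided around-wk y near y≢bk with Path2.ball-x₂ (P k) near y≢bk
  ... | inj₁ refl                = inj₂ (inj₁ ak∈)
  ... | inj₂ (inj₁ refl)         = inj₂ wk-avoided
  ... | inj₂ (inj₂ (inj₁ refl))  = inj₂ (inj₁ u∈)
  ... | inj₂ (inj₂ (inj₂ wk~y))  = inj₂ (inj₁ (around-wk wk~y y≢bk))

  a≢u : ∀ k → a k ≢ u
  a≢u k = adj⇒≢ G (Path2.s~x₁ (P k)) ∘ ≡.sym

  b≢u : ∀ k → b k ≢ u
  b≢u k = deg⇒≢ G (Path2.deg-x₂ (P k)) deg-u λ ()

  aStep : (k : Fin 7) (before : List (Fin 7)) → {True (length before ≤? 5)} → GreedyStep
  aStep k before {short} =
    greedy (a k) (u ∷ w k ∷ map a before)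
           (s≤s (s≤s (≤-trans (≤-reflexive (length-map a before)) (toWitness short))))

  a₀Step : GreedyStep
  a₀Step = greedy (a zero) (u ∷ map a (# 1 ∷ # 2 ∷ # 3 ∷ # 4 ∷ # 5 ∷ # 6 ∷ [])) ≤-refl

  bStep : Fin 7 → GreedyStep
  bStep zero    = greedy (b zero) (a zero ∷ u ∷ otherNeighbours G (w zero) (b zero))
                    (s≤s (s≤s (length-otherNeighbours G (adj-sym G (Path2.x₂~x₃ (P zero))) deg-x₃₀)))
  bStep (suc i) = greedy (b (suc i)) (a (suc i) ∷ u ∷ w (suc i) ∷ otherNeighbours G (w (suc i)) (b (suc i)))
                    (s≤s (s≤s (s≤s (length-otherNeighbours G (adj-sym G (Path2.x₂~x₃ (P (suc i)))) (deg-x₃ i)))))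

  aOrder : List (Fin 7)
  aOrder = # 1 ∷ # 2 ∷ # 3 ∷ # 4 ∷ # 5 ∷ # 6 ∷ # 0 ∷ []

  aOrder-complete : ∀ j → j ∈ aOrder
  aOrder-complete = toWitness {a? = all? (_∈? aOrder)} _
    where open DecMembership _≟_ using (_∈?_)

  greedySteps : List GreedyStep
  greedySteps = aStep (# 1) [] ∷ aStep (# 2) (# 1 ∷ []) ∷ aStep (# 3) (# 1 ∷ # 2 ∷ []) ∷
                aStep (# 4) (# 1 ∷ # 2 ∷ # 3 ∷ []) ∷ aStep (# 5) (# 1 ∷ # 2 ∷ # 3 ∷ # 4 ∷ []) ∷
                aStep (# 6) (# 1 ∷ # 2 ∷ # 3 ∷ # 4 ∷ # 5 ∷ []) ∷ a₀Step ∷ map bStep (allFin 7)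

  ∈-bs : ∀ k xs → b k ∈ xs ++ map b (allFin 7)
  ∈-bs k xs = ∈-++⁺ʳ xs (∈-map⁺ b (∈-allFin k))

  aStep-covered : ∀ k before after {short} → {True (partition? k before after)} →
                      Covered (aStep k before {short}) (map a after ++ map b (allFin 7))
  aStep-covered k before after {_} {partition} =
    a-covered k (here refl) (∈-bs k (map a after)) (inj₁ (there (here refl))) others ,
    inj₁ (a≢u k , x₃₀≢x₁ k ∘ ≡.sym)
    where
      others : ∀ j → j ≢ k → a j ∈ u ∷ w k ∷ map a before ⊎ a j ∈ map a after ++ map b (allFin 7)
      others j j≢k with toWitness partition j
      ... | inj₁ j≡k          = contradiction j≡k j≢k
      ... | inj₂ (inj₁ j∈bef) = inj₁ (there (there (∈-map⁺ a j∈bef)))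
      ... | inj₂ (inj₂ j∈aft) = inj₂ (∈-++⁺ˡ (∈-map⁺ a j∈aft))

  a₀Step-covered : Covered a₀Step (map b (allFin 7))
  a₀Step-covered =
    a-covered zero (here refl) (∈-bs zero []) (inj₂ (refl , here refl)) others ,
    inj₁ (a≢u zero , x₃₀≢x₁ zero ∘ ≡.sym)
    where
      others : ∀ j → j ≢ zero → a j ∈ avoid a₀Step ⊎ a j ∈ map b (allFin 7)
      others zero    0≢0 = contradiction refl 0≢0
      others (suc j) _   = inj₁ (there (∈-map⁺ a (∈-map⁺ suc (∈-allFin j))))

  bStep-covered : ∀ k pending → Covered (bStep k) pending
  bStep-covered zero    pending =
    b-covered zero (here refl) (there (here refl)) (inj₂ (refl , there (here refl)))
              (λ w~y y≢ → there (there (∈-otherNeighbours G w~y y≢))) ,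
    inj₁ (b≢u zero , x₃₀≢x₂ zero ∘ ≡.sym)
  bStep-covered (suc i) pending =
    b-covered (suc i) (here refl) (there (here refl)) (inj₁ (there (there (here refl))))
              (λ w~y y≢ → there (there (there (∈-otherNeighbours G w~y y≢)))) ,
    inj₁ (b≢u (suc i) , x₃₀≢x₂ (suc i) ∘ ≡.sym)

  bSteps-covered : AllCovered (map bStep (allFin 7))
  bSteps-covered = allCovered-map bStep bStep-covered (allFin 7)

  all-covered : AllCovered greedySteps
  all-covered =
    aStep-covered (# 1) [] (# 2 ∷ # 3 ∷ # 4 ∷ # 5 ∷ # 6 ∷ # 0 ∷ []) ,
    aStep-covered (# 2) (# 1 ∷ []) (# 3 ∷ # 4 ∷ # 5 ∷ # 6 ∷ # 0 ∷ []) ,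
    aStep-covered (# 3) (# 1 ∷ # 2 ∷ []) (# 4 ∷ # 5 ∷ # 6 ∷ # 0 ∷ []) ,
    aStep-covered (# 4) (# 1 ∷ # 2 ∷ # 3 ∷ []) (# 5 ∷ # 6 ∷ # 0 ∷ []) ,
    aStep-covered (# 5) (# 1 ∷ # 2 ∷ # 3 ∷ # 4 ∷ []) (# 6 ∷ # 0 ∷ []) ,
    aStep-covered (# 6) (# 1 ∷ # 2 ∷ # 3 ∷ # 4 ∷ # 5 ∷ []) (# 0 ∷ []) ,
    a₀Step-covered ,
    bSteps-covered

  -- u may take the colour of x₃₀ because its whole ball is recoloured afterwards.
  copy-safe : ∀ f → SafeChoice f u (f (w zero)) (recoloured (map toStep greedySteps))
  copy-safe f y (inj₁ u~y) _ with neighbours-u u~y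
  ... | j , refl = inj₁ (∈-++⁺ˡ (∈-map⁺ a (aOrder-complete j)))
  copy-safe f y (inj₂ (m , u~m , m~y)) y≢u with neighbours-u u~m
  ... | j , refl with Path2.neighbours-x₁ (P j) m~y
  ...   | inj₁ y≡u = contradiction y≡u y≢u
  ...   | inj₂ refl = inj₁ (∈-bs j (map a aOrder))

  impossible : ⊥
  impossible = no-safe-recolouring mc (Path2.s~x₁ (P zero)) steps (here refl) a₀∈
                 (λ f → copy-then-greedy-safe f greedySteps x₃₀≢u (copy-safe f) all-covered)
    where
      steps : List Step
      steps = (u , λ f → f (w zero)) ∷ map toStep greedySteps
      a₀∈ : a zero ∈ recoloured steps
      a₀∈ = there (∈-++⁺ˡ (∈-map⁺ a (aOrder-complete zero)))

module TwoTwoZeroNeighbour {G : Graph} (mc : MinimalCounterexample G) {u : V G} (deg-u : deg G u ≡ 7)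
    (P : Fin 6 → Path2 G u) (x₁-injective : Injective _≡_ _≡_ (Path2.x₁ ∘ P))
    (deg-x₃ : ∀ i → deg G (Path2.x₃ (P i)) ≤ 5)
    {v : V G} (u~v : adj G u v ≡ true) (deg-v : deg G v ≡ 3)
    (p q : Path2 G v) (p₁≢q₁ : Path2.x₁ p ≢ Path2.x₁ q) where

  open Recolouring G
  open WithCopy u u
  open Path2 p using () renaming (x₁ to p₁; x₂ to p₂; x₃ to p₃)
  open Path2 q using () renaming (x₁ to q₁; x₂ to q₂; x₃ to q₃)

  a b w : Fin 6 → V G
  a = Path2.x₁ ∘ P
  b = Path2.x₂ ∘ P
  w = Path2.x₃ ∘ P

  neighbours-u : ∀ {y} → adj G u y ≡ true → ∃ λ j → y ≡ (v Vec.∷ a) j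
  neighbours-u = neighbours-listed G deg-u (v Vec.∷ a)
    (injective-from-tail (λ i → deg⇒≢ G deg-v (Path2.deg-x₁ (P i)) λ ()) x₁-injective)
    (λ { zero → u~v ; (suc i) → Path2.s~x₁ (P i) })

  neighbours-v : ∀ {y} → adj G v y ≡ true → y ≡ u ⊎ y ≡ p₁ ⊎ y ≡ q₁
  neighbours-v = neighbours-of-degree-3 G deg-v (adj-sym G u~v) (Path2.s~x₁ p) (Path2.s~x₁ q)
    (deg⇒≢ G deg-u (Path2.deg-x₁ p) λ ()) (deg⇒≢ G deg-u (Path2.deg-x₁ q) λ ()) p₁≢q₁

  bs : List (V G)
  bs = map b (allFin 6)

  ∈-bs : ∀ k xs → b k ∈ xs ++ bs
  ∈-bs k xs = ∈-++⁺ʳ xs (∈-map⁺ b (∈-allFin k))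

  vStep : GreedyStep
  vStep = greedy v (p₂ ∷ q₂ ∷ []) (s≤s (s≤s z≤n))

  aStep : (k : Fin 6) (before : List (Fin 6)) → {True (length before ≤? 5)} → GreedyStep
  aStep k before {short} =
    greedy (a k) (v ∷ w k ∷ map a before)
           (s≤s (s≤s (≤-trans (≤-reflexive (length-map a before)) (toWitness short))))

  uStep : GreedyStep
  uStep = greedy u (v ∷ map a (allFin 6)) ≤-refl

  p₁Step q₁Step : GreedyStep
  p₁Step = greedy p₁ (v ∷ p₂ ∷ p₃ ∷ u ∷ []) (s≤s (s≤s (s≤s (s≤s z≤n))))
  q₁Step = greedy q₁ (v ∷ q₂ ∷ q₃ ∷ u ∷ p₁ ∷ []) (s≤s (s≤s (s≤s (s≤s (s≤s z≤n)))))

  bStep : Fin 6 → GreedyStep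
  bStep i = greedy (b i) (a i ∷ u ∷ w i ∷ otherNeighbours G (w i) (b i))
                   (s≤s (s≤s (s≤s (length-otherNeighbours G (adj-sym G (Path2.x₂~x₃ (P i))) (deg-x₃ i)))))

  greedySteps : List GreedyStep
  greedySteps = vStep ∷ aStep (# 0) [] ∷ aStep (# 1) (# 0 ∷ []) ∷ aStep (# 2) (# 0 ∷ # 1 ∷ []) ∷
                aStep (# 3) (# 0 ∷ # 1 ∷ # 2 ∷ []) ∷ aStep (# 4) (# 0 ∷ # 1 ∷ # 2 ∷ # 3 ∷ []) ∷
                aStep (# 5) (# 0 ∷ # 1 ∷ # 2 ∷ # 3 ∷ # 4 ∷ []) ∷ uStep ∷ p₁Step ∷ q₁Step ∷ map bStep (allFin 6)

  vStep-covered : Covered vStep (map a (allFin 6) ++ u ∷ p₁ ∷ q₁ ∷ bs)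
  vStep-covered = near , inj₂ refl
    where
      later : List (V G)
      later = map a (allFin 6) ++ u ∷ p₁ ∷ q₁ ∷ bs
      u-etc : ∀ {y} → y ≡ u ⊎ y ≡ p₁ ⊎ y ≡ q₁ → y ∈ later
      u-etc (inj₁ refl)        = ∈-++⁺ʳ (map a (allFin 6)) (here refl)
      u-etc (inj₂ (inj₁ refl)) = ∈-++⁺ʳ (map a (allFin 6)) (there (here refl))
      u-etc (inj₂ (inj₂ refl)) = ∈-++⁺ʳ (map a (allFin 6)) (there (there (here refl)))
      near : ∀ y → Dist≤2 G v y → y ≢ v → y ∈ later ⊎ Avoided (p₂ ∷ q₂ ∷ []) y
      near y (inj₁ v~y) _ = inj₁ (u-etc (neighbours-v v~y))
      near y (inj₂ (m , v~m , m~y)) y≢v with neighbours-v v~m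
      ... | inj₁ refl with neighbours-u m~y
      ...   | zero  , y≡v  = contradiction y≡v y≢v
      ...   | suc j , refl = inj₁ (∈-++⁺ˡ (∈-map⁺ a (∈-allFin j)))
      near y (inj₂ (m , v~m , m~y)) y≢v | inj₂ (inj₁ refl) with Path2.neighbours-x₁ p m~y
      ...   | inj₁ y≡v  = contradiction y≡v y≢v
      ...   | inj₂ refl = inj₂ (inj₁ (here refl))
      near y (inj₂ (m , v~m , m~y)) y≢v | inj₂ (inj₂ refl) with Path2.neighbours-x₁ q m~y
      ...   | inj₁ y≡v  = contradiction y≡v y≢v
      ...   | inj₂ refl = inj₂ (inj₁ (there (here refl)))

  aStep-covered : ∀ k before after {short} → {True (partition? k before after)} →
                  Covered (aStep k before {short}) (map a after ++ u ∷ p₁ ∷ q₁ ∷ bs)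
  aStep-covered k before after {_} {partition} = near , inj₂ refl
    where
      later : List (V G)
      later = map a after ++ u ∷ p₁ ∷ q₁ ∷ bs
      F : List (V G)
      F = v ∷ w k ∷ map a before
      near : ∀ y → Dist≤2 G (a k) y → y ≢ a k → y ∈ later ⊎ Avoided F y
      near y d y≢ak with Path2.ball-x₁ (P k) d y≢ak
      ... | inj₁ refl               = inj₁ (∈-++⁺ʳ (map a after) (here refl))
      ... | inj₂ (inj₁ refl)        = inj₁ (∈-++⁺ʳ (map a after) (∈-bs k (u ∷ p₁ ∷ q₁ ∷ [])))
      ... | inj₂ (inj₂ (inj₁ refl)) = inj₂ (inj₁ (there (here refl)))
      ... | inj₂ (inj₂ (inj₂ u~y)) with neighbours-u u~y
      ...   | zero  , refl = inj₂ (inj₁ (here refl))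
      ...   | suc j , refl with toWitness partition j
      ...     | inj₁ refl        = contradiction refl y≢ak
      ...     | inj₂ (inj₁ j∈bef) = inj₂ (inj₁ (there (there (∈-map⁺ a j∈bef))))
      ...     | inj₂ (inj₂ j∈aft) = inj₁ (∈-++⁺ˡ (∈-map⁺ a j∈aft))

  uStep-covered : Covered uStep (p₁ ∷ q₁ ∷ bs)
  uStep-covered = near , inj₂ refl
    where
      near : ∀ y → Dist≤2 G u y → y ≢ u → y ∈ p₁ ∷ q₁ ∷ bs ⊎ Avoided (avoid uStep) y
      near y (inj₁ u~y) _ with neighbours-u u~y
      ... | zero  , refl = inj₂ (inj₁ (here refl))
      ... | suc j , refl = inj₂ (inj₁ (there (∈-map⁺ a (∈-allFin j))))
      near y (inj₂ (m , u~m , m~y)) y≢u with neighbours-u u~m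
      ... | zero , refl with neighbours-v m~y
      ...   | inj₁ y≡u          = contradiction y≡u y≢u
      ...   | inj₂ (inj₁ refl)  = inj₁ (here refl)
      ...   | inj₂ (inj₂ refl)  = inj₁ (there (here refl))
      near y (inj₂ (m , u~m , m~y)) y≢u | suc j , refl with Path2.neighbours-x₁ (P j) m~y
      ...   | inj₁ y≡u  = contradiction y≡u y≢u
      ...   | inj₂ refl = inj₁ (∈-bs j (p₁ ∷ q₁ ∷ []))

  branch-near : ∀ (R : Path2 G v) {F pending} → v ∈ F → Path2.x₂ R ∈ F → Path2.x₃ R ∈ F →
                (∀ {y} → y ≡ u ⊎ y ≡ p₁ ⊎ y ≡ q₁ → y ≢ Path2.x₁ R → y ∈ pending ⊎ y ∈ F) →
                ∀ y → Dist≤2 G (Path2.x₁ R) y → y ≢ Path2.x₁ R → y ∈ pending ⊎ Avoided F y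
  branch-near R v∈ x₂∈ x₃∈ others y d y≢x₁ with Path2.ball-x₁ R d y≢x₁
  ... | inj₁ refl               = inj₂ (inj₁ v∈)
  ... | inj₂ (inj₁ refl)        = inj₂ (inj₁ x₂∈)
  ... | inj₂ (inj₂ (inj₁ refl)) = inj₂ (inj₁ x₃∈)
  ... | inj₂ (inj₂ (inj₂ v~y)) with others (neighbours-v v~y) y≢x₁
  ...   | inj₁ y∈ = inj₁ y∈
  ...   | inj₂ y∈ = inj₂ (inj₁ y∈)

  p₁Step-covered : Covered p₁Step (q₁ ∷ bs)
  p₁Step-covered = branch-near p (here refl) (there (here refl)) (there (there (here refl))) others , inj₂ refl
    where
      others : ∀ {y} → y ≡ u ⊎ y ≡ p₁ ⊎ y ≡ q₁ → y ≢ p₁ → y ∈ q₁ ∷ bs ⊎ y ∈ avoid p₁Step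
      others (inj₁ refl)        _     = inj₂ (there (there (there (here refl))))
      others (inj₂ (inj₁ refl)) y≢p₁ = contradiction refl y≢p₁
      others (inj₂ (inj₂ refl)) _     = inj₁ (here refl)

  q₁Step-covered : Covered q₁Step bs
  q₁Step-covered = branch-near q (here refl) (there (here refl)) (there (there (here refl))) others , inj₂ refl
    where
      others : ∀ {y} → y ≡ u ⊎ y ≡ p₁ ⊎ y ≡ q₁ → y ≢ q₁ → y ∈ bs ⊎ y ∈ avoid q₁Step
      others (inj₁ refl)        _     = inj₂ (there (there (there (here refl))))
      others (inj₂ (inj₁ refl)) _     = inj₂ (there (there (there (there (here refl)))))
      others (inj₂ (inj₂ refl)) y≢q₁ = contradiction refl y≢q₁

  bStep-covered : ∀ i pending → Covered (bStep i) pending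
  bStep-covered i pending = near , inj₂ refl
    where
      near : ∀ y → Dist≤2 G (b i) y → y ≢ b i → y ∈ pending ⊎ Avoided (avoid (bStep i)) y
      near y d y≢bi with Path2.ball-x₂ (P i) d y≢bi
      ... | inj₁ refl               = inj₂ (inj₁ (here refl))
      ... | inj₂ (inj₁ refl)        = inj₂ (inj₁ (there (there (here refl))))
      ... | inj₂ (inj₂ (inj₁ refl)) = inj₂ (inj₁ (there (here refl)))
      ... | inj₂ (inj₂ (inj₂ wi~y)) = inj₂ (inj₁ (there (there (there (∈-otherNeighbours G wi~y y≢bi)))))

  bSteps-covered : AllCovered (map bStep (allFin 6))
  bSteps-covered = allCovered-map bStep bStep-covered (allFin 6)

  all-covered : AllCovered greedySteps
  all-covered =
    vStep-covered ,
    aStep-covered (# 0) [] (# 1 ∷ # 2 ∷ # 3 ∷ # 4 ∷ # 5 ∷ []) ,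
    aStep-covered (# 1) (# 0 ∷ []) (# 2 ∷ # 3 ∷ # 4 ∷ # 5 ∷ []) ,
    aStep-covered (# 2) (# 0 ∷ # 1 ∷ []) (# 3 ∷ # 4 ∷ # 5 ∷ []) ,
    aStep-covered (# 3) (# 0 ∷ # 1 ∷ # 2 ∷ []) (# 4 ∷ # 5 ∷ []) ,
    aStep-covered (# 4) (# 0 ∷ # 1 ∷ # 2 ∷ # 3 ∷ []) (# 5 ∷ []) ,
    aStep-covered (# 5) (# 0 ∷ # 1 ∷ # 2 ∷ # 3 ∷ # 4 ∷ []) [] ,
    uStep-covered ,
    p₁Step-covered ,
    q₁Step-covered ,
    bSteps-covered

  impossible : ⊥
  impossible = no-safe-recolouring mc (Path2.s~x₁ (P zero)) (map toStep greedySteps) u∈ a₀∈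
                 (λ f → greedy-safe f refl greedySteps all-covered)
    where
      u∈ : u ∈ v ∷ map a (allFin 6) ++ u ∷ p₁ ∷ q₁ ∷ bs
      u∈ = there (∈-++⁺ʳ (map a (allFin 6)) (here refl))
      a₀∈ : a zero ∈ v ∷ map a (allFin 6) ++ u ∷ p₁ ∷ q₁ ∷ bs
      a₀∈ = there (here refl)

module SixTwoPaths {G : Graph} (mc : MinimalCounterexample G) {u : V G} (deg-u : deg G u ≡ 7)
    (P : Fin 6 → Path2 G u) (x₁-injective : Injective _≡_ _≡_ (Path2.x₁ ∘ P))
    (deg-x₃ : ∀ i → deg G (Path2.x₃ (P i)) ≤ 5)
    (deg-x₃≢2 : ∀ i → deg G (Path2.x₃ (P i)) ≢ 2) where

  open Path2

  seventh-2-path-impossible : (R : Path2 G u) → (∀ i → x₁ R ≢ x₁ (P i)) → deg G (x₃ R) ≤ 6 → x₃ R ≢ u →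
                              (∀ j → x₃ R ≢ x₁ (P j)) → (∀ j → x₃ R ≢ x₂ (P j)) → ⊥
  seventh-2-path-impossible R R-new deg-x₃R x₃≢u x₃≢x₁ x₃≢x₂ =
    SevenTwoPaths.impossible mc deg-u (R Vec.∷ P) (injective-from-tail R-new x₁-injective) deg-x₃ deg-x₃R x₃≢u
      (λ { zero → x₁≢x₃ R ∘ ≡.sym ; (suc j) → x₃≢x₁ j })
      (λ { zero → adj⇒≢ G (x₂~x₃ R) ∘ ≡.sym ; (suc j) → x₃≢x₂ j })

  no-seventh-2-path : ¬ (∃ λ (x : Fin 4 → V G) → KPathFrom G 2 u x × deg G (endv {G} x) ≤ 6 ×
                                                 (∀ i → second {G} x ≢ x₁ (P i)))
  no-seventh-2-path (x , kp , deg-end , fresh) =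
    seventh-2-path-impossible R fresh deg-end (deg-≤⇒≢ G deg-end (≤-reflexive (≡.sym deg-u)))
      (λ j → deg-≢⇒≢ G (deg-end-2-path G x kp) (deg-x₁ (P j)))
      (λ j → deg-≢⇒≢ G (deg-end-2-path G x kp) (deg-x₂ (P j)))
    where
      R : Path2 G u
      R = path⇒Path2 G x kp

  no-3-path : ¬ (∃ λ (x : Fin 5 → V G) → KPathFrom G 3 u x)
  no-3-path (x , kp) = seventh-2-path-impossible R x₁-new (≤-trans (≤-reflexive deg-x₃R) (s≤s (s≤s z≤n)))
    (deg⇒≢ G deg-x₃R deg-u λ ()) x₃≢x₁ x₃≢x₂
    where
      R : Path2 G u
      R = path⇒Path2 G x kp
      deg-x₃R : deg G (x₃ R) ≡ 2
      deg-x₃R = deg-x₃-3-path G x kp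
      x₂≢u : x₂ R ≢ u
      x₂≢u = s≢x₂ R ∘ ≡.sym
      from : ∀ {z z′ y} → z ≡ z′ → adj G z y ≡ true → adj G z′ y ≡ true
      from z≡z′ = subst (λ z → adj G z _ ≡ true) z≡z′
      -- A walk through degree-2 vertices that meets P j away from u runs into its end, of degree ≠ 2.
      x₁-new : ∀ j → x₁ R ≢ x₁ (P j)
      x₁-new j e = deg-x₃≢2 j (subst (λ z → deg G z ≡ 2)
        (walk-from-x₁ (P j) (from e (x₁~x₂ R)) (x₂~x₃ R) (x₁≢x₃ R ∘ trans e) x₂≢u) deg-x₃R)
      x₃≢x₁ : ∀ j → x₃ R ≢ x₁ (P j)
      x₃≢x₁ j e = deg-x₃≢2 j (subst (λ z → deg G z ≡ 2)
        (walk-from-x₁ (P j) (from e (adj-sym G (x₂~x₃ R))) (adj-sym G (x₁~x₂ R)) (x₁≢x₃ R ∘ ≡.sym ∘ trans e) x₂≢u)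
        (deg-x₁ R))
      x₃≢x₂ : ∀ j → x₃ R ≢ x₂ (P j)
      x₃≢x₂ j e with walk-from-x₂ (P j) (from e (adj-sym G (x₂~x₃ R))) (adj-sym G (x₁~x₂ R))
                       (x₁≢x₃ R ∘ ≡.sym ∘ trans e)
      ... | inj₁ x₂≡w = deg-x₃≢2 j (subst (λ z → deg G z ≡ 2) x₂≡w (deg-x₂ R))
      ... | inj₂ x₁≡u = adj⇒≢ G (s~x₁ R) (≡.sym x₁≡u)

  no-220-neighbour : ∀ v → adj G u v ≡ true → ¬ Is220 G v
  no-220-neighbour v u~v (deg-v , p , q , _ , kp , kq , _ , p₁≢q₁ , _ , _) =
    TwoTwoZeroNeighbour.impossible mc deg-u P x₁-injective deg-x₃ u~v deg-v
      (path⇒Path2 G p kp) (path⇒Path2 G q kq) p₁≢q₁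

lemma12 : (G : Graph) → MinimalCounterexample G →
    (u : V G) → deg G u ≡ 7 →
    (ps : Fin 6 → Fin 4 → V G) →
    (∀ i → KPathFrom G 2 u (ps i)) →
    (∀ i → deg G (endv {G} (ps i)) ≤ 5) →
    (∀ i j → second {G} (ps i) ≡ second {G} (ps j) → i ≡ j) →
    (¬ (∃ λ (x : Fin 5 → V G) → KPathFrom G 3 u x)) ×
    (∀ (v : V G) → adj G u v ≡ true → ¬ Is220 G v) ×
    (¬ (∃ λ (x : Fin 4 → V G) → KPathFrom G 2 u x ×
          deg G (endv {G} x) ≤ 6 ×
          (∀ i → second {G} x ≢ second {G} (ps i))))
lemma12 G mc u deg-u ps kp deg-end distinct = no-3-path , no-220-neighbour , no-seventh-2-path
  where
    open SixTwoPaths mc deg-u (λ i → path⇒Path2 G (ps i) (kp i)) (distinct _ _) deg-end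
                     (λ i → deg-end-2-path G (ps i) (kp i))
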